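{- For $n\geq 5$, let $f_n^1(\sigma)$ be the number of permutations $\pi\in\mathcal{S}_n$ with $\theta(\pi)=\pi$ that avoid $\sigma$. Then $f_n^1(\sigma)=F_{n+1}$ for $\sigma\in\{231,312,321\}$, $f_n^1(\sigma)=2$ for $\sigma\in\{132,213\}$, and $f_n^1(123)=0$.
   Context: $\mathcal{S}_n$ is the symmetric group on $[n]$, permutations in one-line notation $\pi_1\cdots\pi_n$. A permutation avoids a pattern $\tau$ if it has no subsequence order-isomorphic to $\tau$. The standard cycle notation of $\pi$ writes each cycle (fixed points included) with its largest element first and orders cycles by increasing largest element. The fundamental bijection $\theta:\mathcal{S}_n\to\mathcal{S}_n$ maps $\pi$ to the permutation whose one-line notation is obtained by erasing the parentheses of the standard cycle notation of $\pi$. Fibonacci numbers: $F_0=0$, $F_1=F_2=1$, $F_m=F_{m-1}+F_{m-2}$. -}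

module Defs where

open import Data.Nat using (ℕ; zero; suc; _+_; _∸_; _<_; _≤ᵇ_; _≟_)
open import Data.Bool using (Bool; true; false; if_then_else_)
open import Data.List using (List; []; _∷_; length; map; upTo; takeWhile; concatMap)
open import Data.List.Relation.Binary.Permutation.Propositional using (_↭_)
open import Data.List.Relation.Binary.Sublist.Propositional using (_⊆_)
open import Data.List.Relation.Binary.Pointwise using (Pointwise)
open import Data.List.Relation.Unary.Unique.Propositional using (Unique)
open import Data.List.Membership.Propositional using (_∈_)
open import Data.Product using (Σ; _×_)
open import Data.Unit using (⊤)
open import Data.Empty using (⊥)
open import Function.Bundles using (_⇔_)
open import Relation.Nullary using (¬?)
open import Relation.Binary.PropositionalEquality using (_≡_)

F : ℕ → ℕ
F zero = 0
F (suc zero) = 1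
F (suc (suc m)) = F (suc m) + F m

range : ℕ → List ℕ
range n = map suc (upTo n)

-- A permutation of [n] in one-line notation π₁⋯πₙ is a list that is a
-- rearrangement of [1..n].
IsPerm : ℕ → List ℕ → Set
IsPerm n π = π ↭ range n

-- 0-indexed list access (default 0)
at : List ℕ → ℕ → ℕ
at [] _ = 0
at (x ∷ xs) zero = x
at (x ∷ xs) (suc k) = at xs k

app : List ℕ → ℕ → ℕ
app π i = at π (i ∸ 1)

orbit : List ℕ → ℕ → ℕ → List ℕ
orbit π m zero = []
orbit π m (suc k) = m ∷ orbit π (app π m) k

-- the cycle of π containing m, written starting from m: (m, π m, π² m, ...)
cyc : List ℕ → ℕ → List ℕ
cyc π m = m ∷ takeWhile (λ x → ¬? (x ≟ m)) (orbit π (app π m) (length π))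

isCycleMax : List ℕ → ℕ → Bool
isCycleMax π m = allLe (cyc π m)
  where
  allLe : List ℕ → Bool
  allLe [] = true
  allLe (x ∷ xs) = if x ≤ᵇ m then allLe xs else false

-- The fundamental bijection θ: erase the parentheses of the standard cycle
-- notation (each cycle starts with its largest element, cycles ordered by
-- increasing largest element).
θ : ℕ → List ℕ → List ℕ
θ n π = concatMap (λ m → if isCycleMax π m then cyc π m else []) (range n)

OrderIso : List ℕ → List ℕ → Set
OrderIso [] [] = ⊤
OrderIso [] (_ ∷ _) = ⊥
OrderIso (_ ∷ _) [] = ⊥
OrderIso (x ∷ xs) (y ∷ ys) =
  Pointwise (λ x' y' → ((x < x') ⇔ (y < y')) × ((x' < x) ⇔ (y' < y))) xs ys
  × OrderIso xs ys

Contains : List ℕ → List ℕ → Set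
Contains π τ = Σ (List ℕ) λ s → (s ⊆ π) × OrderIso s τ

Avoids : List ℕ → List ℕ → Set
Avoids π τ = Contains π τ → ⊥

FixedAvoider : ℕ → List ℕ → List ℕ → Set
FixedAvoider n σ π = IsPerm n π × (θ n π ≡ π) × Avoids π σ

-- f_n^1(σ) = k : the set {π ∈ S_n | θ π = π, π avoids σ} has exactly k elements
-- (witnessed by a duplicate-free list enumerating exactly this set).
f1≡ : ℕ → List ℕ → ℕ → Set
f1≡ n σ k = Σ (List (List ℕ)) λ L →
  Unique L × ((π : List ℕ) → (π ∈ L) ⇔ FixedAvoider n σ π) × (length L ≡ k)

-- A permutation is fixed by θ exactly when it is layered with layers of size one or two:
-- π = B₁B₂⋯ where each Bᵢ is a fixed point (k+1) or a transposition (k+2 k+1) of the next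
-- unused values. Reading θ(π) = π from left to right past a layered prefix of [k], the next
-- entry m = π(k+1) is the largest element of its cycle. If π(m) = m then m = k+1 by injectivity.
-- Otherwise π(k+2) is the second entry of that cycle, i.e. π(k+2) = π(m), so m = k+2, and
-- y = π(m) satisfies y < m and y ∉ [k], so y = k+1. Splitting off the last layer shows that
-- there are F(n+1) such permutations of [n]. In a layered permutation, two entries with another
-- entry between them lie in different layers and so are increasing. Hence 231, 312 and 321 are
-- avoided. A transposition layer preceded by any entry gives a 132, and one followed by any entry
-- gives a 213, which leaves two permutations in each case. Five or more values need at least three
-- layers, which gives a 123.

module Submission where

open import Defs
open import Data.Nat using (ℕ; zero; suc; _+_; _≤_; _<_; z≤n; s≤s; z<s; s<s; _≡ᵇ_; _≤ᵇ_; _≟_; _≤?_)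
open import Data.Nat.Properties
  using ( +-identityʳ; +-suc; +-comm; m≤m+n; m<m+n; ≤-reflexive; ≤-refl; ≤-trans; ≤-antisym; ≤-pred
        ; <⇒≤; ≤⇒≯; ≤∧≢⇒<; <⇒≢; >⇒≢; <⇒≱; ≮⇒≥; ≰⇒>; n≤1+n; 1+n≢n; 1+n≰n; m≢1+m+n; +-monoˡ-<
        ; ≤-<-trans; <-≤-trans; <-asym; <-trans; module ≤-Reasoning )
open import Data.Bool using (true; false; if_then_else_)
open import Data.List using (List; []; _∷_; _++_; [_]; length; map; concatMap; applyUpTo)
open import Data.List.Properties
  using (++-assoc; ++-identityʳ; length-++; length-++-sucʳ; length-map; map-upTo; concatMap-++; ∷ʳ-injectiveˡ; ∷ʳ-injectiveʳ)
open import Data.List.Relation.Binary.Permutation.Propositional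
  using (_↭_; ↭-refl; ↭-sym; ↭-trans; ↭-swap; ↭-reflexive; ↭⇒↭ₛ; module PermutationReasoning)
import Data.List.Relation.Binary.Permutation.Setoid.Properties as PermutationSetoidProperties
open import Data.List.Relation.Binary.Permutation.Propositional.Properties using (↭-length; ∈-resp-↭; ++⁺ˡ; ++⁺ʳ)
open import Data.List.Relation.Unary.All as All using (All; []; _∷_)
open import Data.List.Relation.Unary.AllPairs as AllPairs using (AllPairs; []; _∷_)
open import Data.List.Relation.Unary.Any using (here; there)
open import Data.List.Relation.Binary.Pointwise using ([]; _∷_)
open import Data.List.Relation.Unary.Unique.Propositional using (Unique)
import Data.List.Relation.Unary.Unique.Propositional.Properties as Unique
open import Data.List.Relation.Binary.Sublist.Propositional using (_⊆_; []; _∷_; _∷ʳ_; to∈; from∈; ⊆-refl; minimum)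
open import Data.List.Relation.Binary.Sublist.Propositional.Properties
  using (length-mono-≤; ∷ˡ⁻; ∷⁻; All-resp-⊆) renaming (++⁺ to ++⁺-⊆; ++⁺ˡ to ++⁺ˡ-⊆; ++⁺ʳ to ++⁺ʳ-⊆)
open import Data.List.Membership.Propositional using (_∈_; _∉_)
open import Data.List.Membership.Propositional.Properties using (∈-++⁺ˡ; ∈-++⁺ʳ; ∈-++⁻; ∈-map⁺; ∈-map⁻)
open import Data.Product using (∃-syntax; _×_; _,_; proj₁; proj₂) renaming (swap to swap×)
open import Data.Sum using (_⊎_; inj₁; inj₂; [_,_]′)
open import Data.Empty using (⊥)
open import Function.Base using (_∘_)
open import Function.Properties.Equivalence using () renaming (sym to ⇔-sym; trans to ⇔-trans)
open import Function.Bundles using (_⇔_; mk⇔; Equivalence)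
open import Relation.Nullary using (¬_; yes; no; contradiction)
open import Relation.Nullary.Decidable using (dec-true; dec-false)
open import Relation.Binary.PropositionalEquality
  using (_≡_; _≢_; refl; sym; trans; cong; cong₂; subst; subst₂; setoid; module ≡-Reasoning)

interval : ℕ → ℕ → List ℕ
interval a zero    = []
interval a (suc c) = a ∷ interval (suc a) c

applyUpTo≡interval : ∀ {f} a c → (∀ i → f i ≡ a + i) → applyUpTo f c ≡ interval a c
applyUpTo≡interval a zero    f≗ = refl
applyUpTo≡interval a (suc c) f≗ =
  cong₂ _∷_ (trans (f≗ 0) (+-identityʳ a))
            (applyUpTo≡interval (suc a) c (λ i → trans (f≗ (suc i)) (+-suc a i)))

range≡interval : ∀ n → range n ≡ interval 1 n
range≡interval n = trans (map-upTo suc n) (applyUpTo≡interval 1 n (λ _ → refl))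

interval-∷ʳ : ∀ a c → interval a (suc c) ≡ interval a c ++ [ a + c ]
interval-∷ʳ a zero    = cong [_] (sym (+-identityʳ a))
interval-∷ʳ a (suc c) =
  cong (a ∷_) (trans (interval-∷ʳ (suc a) c) (cong (λ x → interval (suc a) c ++ [ x ]) (sym (+-suc a c))))

length-interval : ∀ a c → length (interval a c) ≡ c
length-interval a zero    = refl
length-interval a (suc c) = cong suc (length-interval (suc a) c)

∈-interval⁻ : ∀ {x} a c → x ∈ interval a c → a ≤ x × x < a + c
∈-interval⁻ a (suc c) (here refl) = ≤-refl , ≤-trans (s≤s (m≤m+n a c)) (≤-reflexive (sym (+-suc a c)))
∈-interval⁻ a (suc c) (there x∈) with ∈-interval⁻ (suc a) c x∈
... | a<x , x<a+c = <⇒≤ a<x , ≤-trans x<a+c (≤-reflexive (sym (+-suc a c)))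

∈-interval⁺ : ∀ {x} a c → a ≤ x → x < a + c → x ∈ interval a c
∈-interval⁺ {x} a zero    a≤x x<a = contradiction (≤-trans x<a (≤-reflexive (+-identityʳ a))) (≤⇒≯ a≤x)
∈-interval⁺ {x} a (suc c) a≤x x<a+c with a ≟ x
... | yes refl = here refl
... | no a≢x   = there (∈-interval⁺ (suc a) c (≤∧≢⇒< a≤x a≢x) (≤-trans x<a+c (≤-reflexive (+-suc a c))))

interval-increasing : ∀ a c → AllPairs _<_ (interval a c)
interval-increasing a zero    = []
interval-increasing a (suc c) =
  All.tabulate (λ x∈ → proj₁ (∈-interval⁻ (suc a) c x∈)) ∷ interval-increasing (suc a) c

interval-unique : ∀ a c → Unique (interval a c)
interval-unique a c = AllPairs.map <⇒≢ (interval-increasing a c)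

data Layered : ℕ → List ℕ → Set where
  []   : Layered 0 []
  fix  : ∀ {k P} → Layered k P → Layered (suc k) (P ++ [ suc k ])
  swap : ∀ {k P} → Layered k P → Layered (2 + k) (P ++ 2 + k ∷ suc k ∷ [])

Layered⇒↭ : ∀ {k P} → Layered k P → P ↭ interval 1 k
Layered⇒↭ []               = ↭-refl
Layered⇒↭ (fix {k} L)      = ↭-trans (++⁺ʳ [ suc k ] (Layered⇒↭ L)) (↭-reflexive (sym (interval-∷ʳ 1 k)))
Layered⇒↭ (swap {k} {P} L) = begin
  P ++ 2 + k ∷ suc k ∷ []                ↭⟨ ++⁺ʳ _ (Layered⇒↭ L) ⟩
  interval 1 k ++ 2 + k ∷ suc k ∷ []     ↭⟨ ++⁺ˡ (interval 1 k) (↭-swap _ _ ↭-refl) ⟩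
  interval 1 k ++ suc k ∷ 2 + k ∷ []     ≡⟨ sym (++-assoc (interval 1 k) [ suc k ] [ 2 + k ]) ⟩
  (interval 1 k ++ [ suc k ]) ++ [ 2 + k ] ≡⟨ cong (_++ [ 2 + k ]) (sym (interval-∷ʳ 1 k)) ⟩
  interval 1 (suc k) ++ [ 2 + k ]       ≡⟨ sym (interval-∷ʳ 1 (suc k)) ⟩
  interval 1 (2 + k)                     ∎
  where open PermutationReasoning

Layered-length : ∀ {k P} → Layered k P → length P ≡ k
Layered-length {k} L = trans (↭-length (Layered⇒↭ L)) (length-interval 1 k)

Layered-bounded : ∀ {k P x} → Layered k P → x ∈ P → x ≤ k
Layered-bounded {k} L x∈P = ≤-pred (proj₂ (∈-interval⁻ 1 k (∈-resp-↭ (Layered⇒↭ L) x∈P)))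

Layered-covers : ∀ {k P x} → Layered k P → 1 ≤ x → x ≤ k → x ∈ P
Layered-covers {k} L 1≤x x≤k = ∈-resp-↭ (↭-sym (Layered⇒↭ L)) (∈-interval⁺ 1 k 1≤x (s≤s x≤k))

layerings : ℕ → List (List ℕ)
layerings zero          = [ [] ]
layerings (suc zero)    = [ [ 1 ] ]
layerings (suc (suc k)) =
  map (_++ [ 2 + k ]) (layerings (suc k)) ++ map (_++ 2 + k ∷ suc k ∷ []) (layerings k)

length-layerings : ∀ n → length (layerings n) ≡ F (suc n)
length-layerings zero          = refl
length-layerings (suc zero)    = refl
length-layerings (suc (suc k)) = begin
  length (map _ (layerings (suc k)) ++ map _ (layerings k))  ≡⟨ length-++ (map _ (layerings (suc k))) ⟩
  length (map _ (layerings (suc k))) + length (map _ (layerings k))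
    ≡⟨ cong₂ _+_ (length-map _ (layerings (suc k))) (length-map _ (layerings k)) ⟩
  length (layerings (suc k)) + length (layerings k)
    ≡⟨ cong₂ _+_ (length-layerings (suc k)) (length-layerings k) ⟩
  F (2 + k) + F (suc k)                                      ∎
  where open ≡-Reasoning

∈-map-Layered : ∀ {k l f Ps P} → (∀ {Q} → Layered k Q → Layered l (f Q)) →
                (∀ {Q} → Q ∈ Ps → Layered k Q) → P ∈ map f Ps → Layered l P
∈-map-Layered extend Ps-layered P∈ with Q , Q∈ , refl ← ∈-map⁻ _ P∈ = extend (Ps-layered Q∈)

∈-layerings⁻ : ∀ n {P} → P ∈ layerings n → Layered n P
∈-layerings⁻ zero          (here refl) = []
∈-layerings⁻ (suc zero)    (here refl) = fix []
∈-layerings⁻ (suc (suc k)) P∈ =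
  [ ∈-map-Layered fix (∈-layerings⁻ (suc k)) , ∈-map-Layered swap (∈-layerings⁻ k) ]′
  (∈-++⁻ (map _ (layerings (suc k))) P∈)

∈-layerings⁺ : ∀ {n P} → Layered n P → P ∈ layerings n
∈-layerings⁺ []             = here refl
∈-layerings⁺ (fix [])       = here refl
∈-layerings⁺ (fix {suc k} L) = ∈-++⁺ˡ (∈-map⁺ _ (∈-layerings⁺ L))
∈-layerings⁺ (swap {k} L)   = ∈-++⁺ʳ (map _ (layerings (suc k))) (∈-map⁺ _ (∈-layerings⁺ L))

layerings-unique : ∀ n → Unique (layerings n)
layerings-unique zero          = [] ∷ []
layerings-unique (suc zero)    = [] ∷ []
layerings-unique (suc (suc k)) =
  Unique.++⁺ (Unique.map⁺ (∷ʳ-injectiveˡ _ _) (layerings-unique (suc k)))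
             (Unique.map⁺ ++-swap-injective (layerings-unique k))
             disjoint
  where
  ++-swap-injective : ∀ {P Q} → P ++ 2 + k ∷ suc k ∷ [] ≡ Q ++ 2 + k ∷ suc k ∷ [] → P ≡ Q
  ++-swap-injective {P} {Q} eq = ∷ʳ-injectiveˡ P Q (∷ʳ-injectiveˡ (P ++ [ 2 + k ]) (Q ++ [ 2 + k ])
    (trans (++-assoc P [ 2 + k ] [ suc k ]) (trans eq (sym (++-assoc Q [ 2 + k ] [ suc k ])))))
  disjoint : ∀ {P} → P ∈ map (_++ [ 2 + k ]) (layerings (suc k)) × P ∈ map (_++ 2 + k ∷ suc k ∷ []) (layerings k) →
             ⊥
  disjoint (P∈₁ , P∈₂) with ∈-map⁻ _ P∈₁ | ∈-map⁻ _ P∈₂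
  ... | Q , _ , refl | R , _ , eq =
    1+n≢n (∷ʳ-injectiveʳ Q (R ++ [ 2 + k ]) (trans eq (sym (++-assoc R [ 2 + k ] [ suc k ]))))

at-∈ : ∀ xs {i} → i < length xs → at xs i ∈ xs
at-∈ (x ∷ xs) {zero}  _         = here refl
at-∈ (x ∷ xs) {suc i} (s<s i<) = there (at-∈ xs i<)

at-injective : ∀ {xs i j} → Unique xs → i < length xs → j < length xs → at xs i ≡ at xs j → i ≡ j
at-injective {_ ∷ xs} {zero}  {zero}  _          _        _        _  = refl
at-injective {_ ∷ xs} {zero}  {suc j} (x∉ ∷ _)   _        (s<s j<) eq = contradiction eq (All.lookup x∉ (at-∈ xs j<))
at-injective {_ ∷ xs} {suc i} {zero}  (x∉ ∷ _)   (s<s i<) _        eq = contradiction (sym eq) (All.lookup x∉ (at-∈ xs i<))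
at-injective {_ ∷ xs} {suc i} {suc j} (_ ∷ uniq) (s<s i<) (s<s j<) eq = cong suc (at-injective uniq i< j< eq)

unique-++-disjoint : ∀ (P : List ℕ) {R x} → Unique (P ++ R) → x ∈ P → x ∉ R
unique-++-disjoint (_ ∷ P) (x∉ ∷ _) (here refl) x∈R = All.lookup x∉ (∈-++⁺ʳ P x∈R) refl
unique-++-disjoint (_ ∷ P) (_ ∷ uniq) (there x∈P) = unique-++-disjoint P uniq x∈P

-- `does (x ≟ y)` and `does (x ≤? y)` compute to `x ≡ᵇ y` and `x ≤ᵇ y`, so rewriting with the
-- equations below (and with `length π ≡ suc L`, which lets `orbit` unfold) evaluates `cyc`
-- and `isCycleMax` on concrete cycles.
≡ᵇ-refl : ∀ x → (x ≡ᵇ x) ≡ true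
≡ᵇ-refl x = dec-true (x ≟ x) refl

≡ᵇ-false : ∀ {x y} → x ≢ y → (x ≡ᵇ y) ≡ false
≡ᵇ-false = dec-false (_ ≟ _)

≤ᵇ-true : ∀ {x y} → x ≤ y → (x ≤ᵇ y) ≡ true
≤ᵇ-true = dec-true (_ ≤? _)

≤ᵇ-false : ∀ {x y} → ¬ x ≤ y → (x ≤ᵇ y) ≡ false
≤ᵇ-false = dec-false (_ ≤? _)

cycleBlock : List ℕ → ℕ → List ℕ
cycleBlock π m = if isCycleMax π m then cyc π m else []

θ≡concatMap-cycleBlock : ∀ n π → θ n π ≡ concatMap (cycleBlock π) (interval 1 n)
θ≡concatMap-cycleBlock n π = cong (concatMap (cycleBlock π)) (range≡interval n)

cycleBlock-max : ∀ π m → isCycleMax π m ≡ true → cycleBlock π m ≡ cyc π m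
cycleBlock-max π m isMax rewrite isMax = refl

cycleBlock-fixed : ∀ π m {L} → length π ≡ suc L → app π m ≡ m → cycleBlock π m ≡ [ m ]
cycleBlock-fixed π m |π| πm rewrite |π| | πm | ≡ᵇ-refl m | ≤ᵇ-true (≤-refl {m}) = refl

cycleBlock-ascent : ∀ π m {L} → length π ≡ suc L → m < app π m → cycleBlock π m ≡ []
cycleBlock-ascent π m |π| m<πm
  rewrite |π| | ≡ᵇ-false (>⇒≢ m<πm) | ≤ᵇ-true (≤-refl {m}) | ≤ᵇ-false (<⇒≱ m<πm) = refl

cycleBlock-transposition : ∀ π m {y L} → length π ≡ suc (suc L) → app π m ≡ y → app π y ≡ m → y < m →
                           cycleBlock π m ≡ m ∷ y ∷ []
cycleBlock-transposition π m |π| πm πy y<m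
  rewrite |π| | πm | πy | ≡ᵇ-false (<⇒≢ y<m) | ≡ᵇ-refl m
        | ≤ᵇ-true (≤-refl {m}) | ≤ᵇ-true (<⇒≤ y<m) = refl

cyc-∷ : ∀ π m {L} → length π ≡ suc L → app π m ≢ m → ∃[ zs ] cyc π m ≡ m ∷ app π m ∷ zs
cyc-∷ π m |π| πm≢m rewrite |π| | ≡ᵇ-false πm≢m = _ , refl

cycleMax-image-≤ : ∀ π m {L} → length π ≡ suc L → isCycleMax π m ≡ true → app π m ≤ m
cycleMax-image-≤ π m |π| isMax =
  ≮⇒≥ λ m<πm → cyc≢[] (trans (sym (cycleBlock-max π m isMax)) (cycleBlock-ascent π m |π| m<πm))
  where
  cyc≢[] : cyc π m ≢ []
  cyc≢[] ()

at-++ʳ : ∀ P {R} i → at (P ++ R) (i + length P) ≡ at R i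
at-++ʳ []      {R} i rewrite +-identityʳ i = refl
at-++ʳ (_ ∷ P)     i rewrite +-suc i (length P) = at-++ʳ P i

app-after : ∀ {π k P R} → Layered k P → π ≡ P ++ R → ∀ i → app π (suc (i + k)) ≡ at R i
app-after {P = P} {R} L refl i = subst (λ k → at (P ++ R) (i + k) ≡ at R i) (Layered-length L) (at-++ʳ P i)

concatMap-interval-∷ʳ : ∀ (f : ℕ → List ℕ) k →
                        concatMap f (interval 1 (suc k)) ≡ concatMap f (interval 1 k) ++ f (suc k)
concatMap-interval-∷ʳ f k = begin
  concatMap f (interval 1 (suc k))                   ≡⟨ cong (concatMap f) (interval-∷ʳ 1 k) ⟩
  concatMap f (interval 1 k ++ [ suc k ])           ≡⟨ concatMap-++ f (interval 1 k) [ suc k ] ⟩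
  concatMap f (interval 1 k) ++ (f (suc k) ++ [])    ≡⟨ cong (concatMap f (interval 1 k) ++_) (++-identityʳ (f (suc k))) ⟩
  concatMap f (interval 1 k) ++ f (suc k)            ∎
  where open ≡-Reasoning

concatMap-cycleBlock-prefix : ∀ {π k P} R → Layered k P → π ≡ P ++ R →
                              concatMap (cycleBlock π) (interval 1 k) ≡ P
concatMap-cycleBlock-prefix R [] _ = refl
concatMap-cycleBlock-prefix {π} R (fix {k} {P} L) π≡ = begin
  concatMap (cycleBlock π) (interval 1 (suc k))             ≡⟨ concatMap-interval-∷ʳ (cycleBlock π) k ⟩
  concatMap (cycleBlock π) (interval 1 k) ++ cycleBlock π (suc k)
    ≡⟨ cong₂ _++_ (concatMap-cycleBlock-prefix (suc k ∷ R) L π≡′) (cycleBlock-fixed π (suc k) |π| πk) ⟩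
  P ++ [ suc k ]                                            ∎
  where
  open ≡-Reasoning
  π≡′ : π ≡ P ++ suc k ∷ R
  π≡′ = trans π≡ (++-assoc P [ suc k ] R)
  |π| : length π ≡ suc (length (P ++ R))
  |π| = trans (cong length π≡′) (length-++-sucʳ P (suc k) R)
  πk : app π (suc k) ≡ suc k
  πk = app-after L π≡′ 0
concatMap-cycleBlock-prefix {π} R (swap {k} {P} L) π≡ = begin
  concatMap (cycleBlock π) (interval 1 (2 + k))
    ≡⟨ concatMap-interval-∷ʳ (cycleBlock π) (suc k) ⟩
  concatMap (cycleBlock π) (interval 1 (suc k)) ++ cycleBlock π (2 + k)
    ≡⟨ cong (_++ cycleBlock π (2 + k)) (concatMap-interval-∷ʳ (cycleBlock π) k) ⟩
  (concatMap (cycleBlock π) (interval 1 k) ++ cycleBlock π (suc k)) ++ cycleBlock π (2 + k)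
    ≡⟨ ++-assoc (concatMap (cycleBlock π) (interval 1 k)) _ _ ⟩
  concatMap (cycleBlock π) (interval 1 k) ++ cycleBlock π (suc k) ++ cycleBlock π (2 + k)
    ≡⟨ cong₂ _++_ (concatMap-cycleBlock-prefix (2 + k ∷ suc k ∷ R) L π≡′)
                  (cong₂ _++_ (cycleBlock-ascent π (suc k) |π| (≤-reflexive (sym πk)))
                              (cycleBlock-transposition π (2 + k) |π| π[2+k] πk ≤-refl)) ⟩
  P ++ 2 + k ∷ suc k ∷ []                                   ∎
  where
  open ≡-Reasoning
  π≡′ : π ≡ P ++ 2 + k ∷ suc k ∷ R
  π≡′ = trans π≡ (++-assoc P (2 + k ∷ suc k ∷ []) R)
  |π| : length π ≡ suc (suc (length (P ++ R)))
  |π| = trans (cong length π≡′)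
              (trans (length-++-sucʳ P (2 + k) (suc k ∷ R)) (cong suc (length-++-sucʳ P (suc k) R)))
  πk : app π (suc k) ≡ 2 + k
  πk = app-after L π≡′ 0
  π[2+k] : app π (2 + k) ≡ suc k
  π[2+k] = app-after L π≡′ 1

Layered⇒θ-fixed : ∀ {n π} → Layered n π → θ n π ≡ π
Layered⇒θ-fixed {n} {π} L =
  trans (θ≡concatMap-cycleBlock n π) (concatMap-cycleBlock-prefix [] L (sym (++-identityʳ π)))

firstCycle : ∀ π a c → concatMap (cycleBlock π) (interval a c) ≢ [] →
             ∃[ m ] a ≤ m × isCycleMax π m ≡ true ×
                    ∃[ rest ] concatMap (cycleBlock π) (interval a c) ≡ cyc π m ++ rest
firstCycle π a zero    nonEmpty = contradiction refl nonEmpty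
firstCycle π a (suc c) nonEmpty with isCycleMax π a in isMax
... | true  = a , ≤-refl , isMax , _ , refl
... | false with m , a<m , mMax , rest , eq ← firstCycle π (suc a) c nonEmpty = m , <⇒≤ a<m , mMax , rest , eq

Unique-resp-↭ : ∀ {xs ys : List ℕ} → xs ↭ ys → Unique xs → Unique ys
Unique-resp-↭ xs↭ys = ↭ₛ.Unique-resp-↭ (↭⇒↭ₛ xs↭ys)
  where module ↭ₛ = PermutationSetoidProperties (setoid ℕ)

module θ-Fixed {n π} (π↭ : π ↭ interval 1 n) where

  |π|≡n : length π ≡ n
  |π|≡n = trans (↭-length π↭) (length-interval 1 n)

  π-unique : Unique π
  π-unique = Unique-resp-↭ (↭-sym π↭) (interval-unique 1 n)

  ∈π⇒bounded : ∀ {x} → x ∈ π → 1 ≤ x × x ≤ n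
  ∈π⇒bounded x∈π with 1≤x , x<1+n ← ∈-interval⁻ 1 n (∈-resp-↭ π↭ x∈π) = 1≤x , ≤-pred x<1+n

  app∈π : ∀ {i} → i < n → app π (suc i) ∈ π
  app∈π i<n = at-∈ π (subst (_ <_) (sym |π|≡n) i<n)

  app-injective : ∀ {i j} → i < n → j < n → app π (suc i) ≡ app π (suc j) → i ≡ j
  app-injective i<n j<n = at-injective π-unique (subst (_ <_) (sym |π|≡n) i<n) (subst (_ <_) (sym |π|≡n) j<n)

  position-bound : ∀ {k P R} → Layered k P → π ≡ P ++ R → ∀ {i} → i < length R → i + k < n
  position-bound {k} {P} {R} L π≡ {i} i<|R| = begin-strict
    i + k                    <⟨ +-monoˡ-< k i<|R| ⟩
    length R + k             ≡⟨ +-comm (length R) k ⟩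
    k + length R             ≡⟨ cong (_+ length R) (sym (Layered-length L)) ⟩
    length P + length R      ≡⟨ sym (length-++ P) ⟩
    length (P ++ R)          ≡⟨ cong length (sym π≡) ⟩
    length π                 ≡⟨ |π|≡n ⟩
    n                        ∎
    where open ≤-Reasoning

  blocks : ℕ → ℕ → List ℕ
  blocks a c = concatMap (cycleBlock π) (interval a c)

  |π|≡suc : ∀ {k c} → k + suc c ≡ n → length π ≡ suc (k + c)
  |π|≡suc {k} {c} k+1+c≡n = trans |π|≡n (trans (sym k+1+c≡n) (+-suc k c))

  blocks-nonEmpty : ∀ {k c P} → Layered k P → k + suc c ≡ n → π ≡ P ++ blocks (suc k) (suc c) →
                    blocks (suc k) (suc c) ≢ []
  blocks-nonEmpty {k} {c} {P} L k+1+c≡n π≡ empty = m≢1+m+n k (begin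
    k                                    ≡⟨ Layered-length L ⟨
    length P                             ≡⟨ cong length (++-identityʳ P) ⟨
    length (P ++ [])                     ≡⟨ cong (λ R → length (P ++ R)) empty ⟨
    length (P ++ blocks (suc k) (suc c)) ≡⟨ cong length π≡ ⟨
    length π                             ≡⟨ |π|≡suc k+1+c≡n ⟩
    suc (k + c)                          ∎)
    where open ≡-Reasoning

  firstBlock-head : ∀ {k c P} → Layered k P → k + suc c ≡ n → π ≡ P ++ blocks (suc k) (suc c) →
                    ∃[ m ] k < m × isCycleMax π m ≡ true × ∃[ rest ] π ≡ P ++ cyc π m ++ rest
  firstBlock-head {k} {c} {P} L k+1+c≡n π≡
    with m , k<m , isMax , rest , blocks≡ ← firstCycle π (suc k) (suc c) (blocks-nonEmpty L k+1+c≡n π≡)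
    = m , k<m , isMax , rest , trans π≡ (cong (P ++_) blocks≡)

  head-fixed : ∀ {k P m rest} → Layered k P → π ≡ P ++ suc m ∷ rest →
               app π (suc m) ≡ suc m → app π (suc k) ≡ suc k
  head-fixed {k} {P} {m} L π≡ πm≡m = trans πk≡m (cong suc (app-injective m<n k<n (trans πm≡m (sym πk≡m))))
    where
    πk≡m = app-after L π≡ 0
    k<n = position-bound L π≡ z<s
    m<n = proj₂ (∈π⇒bounded (subst (_∈ π) πk≡m (app∈π k<n)))

  head-transposition : ∀ {k P m y rest} → Layered k P → π ≡ P ++ suc m ∷ y ∷ rest →
                       app π (suc m) ≡ y → y ≤ suc m → y ≢ suc m →
                       app π (suc k) ≡ 2 + k × app π (2 + k) ≡ suc k
  head-transposition {k} {P} {m} {y} L π≡ πm≡y y≤m y≢m =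
    subst (λ i → app π (suc k) ≡ suc i) m≡1+k πk≡m , trans π[2+k]≡y y≡1+k
    where
    πk≡m = app-after L π≡ 0
    π[2+k]≡y = app-after L π≡ 1
    k<n = position-bound L π≡ z<s
    1+k<n = position-bound L π≡ (s<s z<s)
    m<n = proj₂ (∈π⇒bounded (subst (_∈ π) πk≡m (app∈π k<n)))
    m≡1+k = app-injective m<n 1+k<n (trans πm≡y (sym π[2+k]≡y))
    y∉P : y ∉ P
    y∉P y∈P = unique-++-disjoint P (subst Unique π≡ π-unique) y∈P (there (here refl))
    k<y : k < y
    k<y = ≰⇒> (y∉P ∘ Layered-covers L (proj₁ (∈π⇒bounded (subst (_∈ π) π[2+k]≡y (app∈π 1+k<n)))))
    y≡1+k : y ≡ suc k
    y≡1+k = ≤-antisym (subst (y ≤_) m≡1+k (≤-pred (≤∧≢⇒< y≤m y≢m))) k<y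

  firstBlock-shape : ∀ {k c P} → Layered k P → k + suc c ≡ n → π ≡ P ++ blocks (suc k) (suc c) →
                     app π (suc k) ≡ suc k ⊎ (app π (suc k) ≡ 2 + k × app π (2 + k) ≡ suc k)
  firstBlock-shape {P = P} L k+1+c≡n π≡ with firstBlock-head L k+1+c≡n π≡
  ... | suc m , _ , isMax , rest , π≡′ with app π (suc m) ≟ suc m
  ...   | yes πm≡m = inj₁ (head-fixed L π≡′ πm≡m)
  ...   | no  πm≢m with zs , cyc≡ ← cyc-∷ π (suc m) (|π|≡suc k+1+c≡n) πm≢m =
    inj₂ (head-transposition L (trans π≡′ (cong (λ C → P ++ C ++ rest) cyc≡)) refl
                             (cycleMax-image-≤ π (suc m) (|π|≡suc k+1+c≡n) isMax) πm≢m)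

  extend-fix : ∀ {k c P} → k + suc c ≡ n → π ≡ P ++ blocks (suc k) (suc c) → app π (suc k) ≡ suc k →
               π ≡ (P ++ [ suc k ]) ++ blocks (2 + k) c
  extend-fix {k} {c} {P} k+1+c≡n π≡ πk≡k = begin
    π                                              ≡⟨ π≡ ⟩
    P ++ cycleBlock π (suc k) ++ blocks (2 + k) c
      ≡⟨ cong (λ B → P ++ B ++ blocks (2 + k) c) (cycleBlock-fixed π (suc k) (|π|≡suc k+1+c≡n) πk≡k) ⟩
    P ++ suc k ∷ blocks (2 + k) c                  ≡⟨ ++-assoc P [ suc k ] _ ⟨
    (P ++ [ suc k ]) ++ blocks (2 + k) c           ∎
    where open ≡-Reasoning

  extend-swap : ∀ {k c P} → k + suc c ≡ n → π ≡ P ++ blocks (suc k) (suc c) →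
                app π (suc k) ≡ 2 + k → app π (2 + k) ≡ suc k →
                ∃[ c′ ] c ≡ suc c′ × π ≡ (P ++ 2 + k ∷ suc k ∷ []) ++ blocks (3 + k) c′
  extend-swap {k} {zero} k+1≡n π≡ πk≡2+k _ =
    contradiction (subst (_∈ π) πk≡2+k (app∈π (subst (k <_) k+1≡n (m<m+n k z<s))))
                  (λ 2+k∈π → 1+n≰n (≤-trans (proj₂ (∈π⇒bounded 2+k∈π))
                                            (≤-reflexive (trans (sym k+1≡n) (+-comm k 1)))))
  extend-swap {k} {suc c} {P} k+2+c≡n π≡ πk≡2+k π[2+k]≡1+k = c , refl , (begin
    π                                                                          ≡⟨ π≡ ⟩
    P ++ cycleBlock π (suc k) ++ cycleBlock π (2 + k) ++ blocks (3 + k) c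
      ≡⟨ cong (λ B → P ++ B ++ cycleBlock π (2 + k) ++ blocks (3 + k) c)
              (cycleBlock-ascent π (suc k) |π| (≤-reflexive (sym πk≡2+k))) ⟩
    P ++ cycleBlock π (2 + k) ++ blocks (3 + k) c
      ≡⟨ cong (λ B → P ++ B ++ blocks (3 + k) c)
              (cycleBlock-transposition π (2 + k) |π| π[2+k]≡1+k πk≡2+k ≤-refl) ⟩
    P ++ 2 + k ∷ suc k ∷ blocks (3 + k) c                  ≡⟨ ++-assoc P (2 + k ∷ suc k ∷ []) _ ⟨
    (P ++ 2 + k ∷ suc k ∷ []) ++ blocks (3 + k) c          ∎)
    where
    open ≡-Reasoning
    |π| : length π ≡ suc (suc (k + c))
    |π| = trans (|π|≡suc k+2+c≡n) (cong suc (+-suc k c))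

  layered-from : ∀ c {k P} → Layered k P → k + c ≡ n → π ≡ P ++ blocks (suc k) c → Layered n π
  layered-from zero {k} L k+0≡n π≡ =
    subst₂ Layered (trans (sym (+-identityʳ k)) k+0≡n) (sym (trans π≡ (++-identityʳ _))) L
  layered-from (suc c) {k} {P} L k+1+c≡n π≡ with firstBlock-shape L k+1+c≡n π≡
  ... | inj₁ πk≡k = layered-from c (fix L) (trans (sym (+-suc k c)) k+1+c≡n) (extend-fix k+1+c≡n π≡ πk≡k)
  ... | inj₂ (πk≡2+k , π[2+k]≡1+k) with c′ , refl , π≡′ ← extend-swap {P = P} k+1+c≡n π≡ πk≡2+k π[2+k]≡1+k =
    layered-from c′ (swap L) (trans (cong suc (sym (+-suc k c′))) (trans (sym (+-suc k (suc c′))) k+1+c≡n))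
                 π≡′

θ-fixed⇔Layered : ∀ {n π} → (IsPerm n π × θ n π ≡ π) ⇔ Layered n π
θ-fixed⇔Layered {n} {π} = mk⇔ to from
  where
  to : IsPerm n π × θ n π ≡ π → Layered n π
  to (π↭ , θπ≡π) = θ-Fixed.layered-from (subst (π ↭_) (range≡interval n) π↭) n [] refl
                     (trans (sym θπ≡π) (θ≡concatMap-cycleBlock n π))
  from : Layered n π → IsPerm n π × θ n π ≡ π
  from L = subst (π ↭_) (sym (range≡interval n)) (Layered⇒↭ L) , Layered⇒θ-fixed L

⊆-++⁻ : ∀ (P : List ℕ) {Q s} → s ⊆ P ++ Q → ∃[ s₁ ] ∃[ s₂ ] s ≡ s₁ ++ s₂ × s₁ ⊆ P × s₂ ⊆ Q
⊆-++⁻ []      s⊆Q        = [] , _ , refl , [] , s⊆Q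
⊆-++⁻ (x ∷ P) (.x ∷ʳ s⊆) with s₁ , s₂ , refl , s₁⊆P , s₂⊆Q ← ⊆-++⁻ P s⊆ =
  s₁ , s₂ , refl , x ∷ʳ s₁⊆P , s₂⊆Q
⊆-++⁻ (x ∷ P) (refl ∷ s⊆) with s₁ , s₂ , refl , s₁⊆P , s₂⊆Q ← ⊆-++⁻ P s⊆ =
  x ∷ s₁ , s₂ , refl , refl ∷ s₁⊆P , s₂⊆Q

⊆-++-triple : ∀ P {Q a b c} → length Q ≤ 2 → a ∷ b ∷ c ∷ [] ⊆ P ++ Q →
              a ∷ b ∷ c ∷ [] ⊆ P ⊎ (a ∷ b ∷ [] ⊆ P × c ∈ Q) ⊎ (a ∈ P × b ∷ c ∷ [] ⊆ Q)
⊆-++-triple P |Q|≤2 t with ⊆-++⁻ P t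
... | []                , _ , refl , _    , abc⊆Q =
  contradiction (≤-trans (length-mono-≤ abc⊆Q) |Q|≤2) λ { (s≤s (s≤s ())) }
... | _ ∷ []            , _ , refl , a⊆P  , bc⊆Q  = inj₂ (inj₂ (to∈ a⊆P , bc⊆Q))
... | _ ∷ _ ∷ []        , _ , refl , ab⊆P , c⊆Q   = inj₂ (inj₁ (ab⊆P , to∈ c⊆Q))
... | _ ∷ _ ∷ _ ∷ []    , [] , refl , abc⊆P , _   = inj₁ abc⊆P
... | _ ∷ _ ∷ _ ∷ _ ∷ _ , _ , () , _ , _

FirstBelowThird : List ℕ → Set
FirstBelowThird P = ∀ {a b c} → a ∷ b ∷ c ∷ [] ⊆ P → a < c

FirstBelowThird-++ : ∀ {P Q} → (∀ {x y} → x ∈ P → y ∈ Q → x < y) → length Q ≤ 2 →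
                     FirstBelowThird P → FirstBelowThird (P ++ Q)
FirstBelowThird-++ {P} P<Q |Q|≤2 inP t with ⊆-++-triple P |Q|≤2 t
... | inj₁ abc⊆P               = inP abc⊆P
... | inj₂ (inj₁ (ab⊆P , c∈Q)) = P<Q (to∈ ab⊆P) c∈Q
... | inj₂ (inj₂ (a∈P , bc⊆Q)) = P<Q a∈P (to∈ (∷ˡ⁻ bc⊆Q))

Layered-below : ∀ {k P Q x y} → Layered k P → All (k <_) Q → x ∈ P → y ∈ Q → x < y
Layered-below L k<Q x∈P y∈Q = ≤-<-trans (Layered-bounded L x∈P) (All.lookup k<Q y∈Q)

Layered⇒FirstBelowThird : ∀ {k P} → Layered k P → FirstBelowThird P
Layered⇒FirstBelowThird []       ()
Layered⇒FirstBelowThird (fix L)  =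
  FirstBelowThird-++ (Layered-below L (≤-refl ∷ [])) (s≤s z≤n) (Layered⇒FirstBelowThird L)
Layered⇒FirstBelowThird (swap L) =
  FirstBelowThird-++ (Layered-below L (n≤1+n _ ∷ ≤-refl ∷ [])) ≤-refl (Layered⇒FirstBelowThird L)

SameOrder : ℕ → ℕ → ℕ → ℕ → Set
SameOrder a b x y = ((a < b) ⇔ (x < y)) × ((b < a) ⇔ (y < x))

ascending : ∀ {a b x y} → a < b → x < y → SameOrder a b x y
ascending a<b x<y = mk⇔ (λ _ → x<y) (λ _ → a<b) ,
                    mk⇔ (λ b<a → contradiction b<a (<-asym a<b)) (λ y<x → contradiction y<x (<-asym x<y))

descending : ∀ {a b x y} → b < a → y < x → SameOrder a b x y
descending b<a y<x = swap× (ascending b<a y<x)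

orderIso₃ : ∀ {a b c x y z} → SameOrder a b x y → SameOrder a c x z → SameOrder b c y z →
            OrderIso (a ∷ b ∷ c ∷ []) (x ∷ y ∷ z ∷ [])
orderIso₃ ab ac bc = (ab ∷ ac ∷ []) , (bc ∷ []) , [] , _

inversion₁₂ : ∀ {a b c x y z} → OrderIso (a ∷ b ∷ c ∷ []) (x ∷ y ∷ z ∷ []) → y < x → b < a
inversion₁₂ ((ab ∷ _) , _) = Equivalence.from (proj₂ ab)

inversion₁₃ : ∀ {a b c x y z} → OrderIso (a ∷ b ∷ c ∷ []) (x ∷ y ∷ z ∷ []) → z < x → c < a
inversion₁₃ ((_ ∷ ac ∷ []) , _) = Equivalence.from (proj₂ ac)

inversion₂₃ : ∀ {a b c x y z} → OrderIso (a ∷ b ∷ c ∷ []) (x ∷ y ∷ z ∷ []) → z < y → c < b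
inversion₂₃ (_ , (bc ∷ []) , _) = Equivalence.from (proj₂ bc)

occurrence₃ : ∀ {π x y z} → Contains π (x ∷ y ∷ z ∷ []) →
              ∃[ a ] ∃[ b ] ∃[ c ] a ∷ b ∷ c ∷ [] ⊆ π × OrderIso (a ∷ b ∷ c ∷ []) (x ∷ y ∷ z ∷ [])
occurrence₃ ([]                , _   , ())
occurrence₃ (_ ∷ []            , _   , () , _)
occurrence₃ (_ ∷ _ ∷ []        , _   , (_ ∷ ()) , _)
occurrence₃ (a ∷ b ∷ c ∷ []    , abc⊆ , iso) = a , b , c , abc⊆ , iso
occurrence₃ (_ ∷ _ ∷ _ ∷ _ ∷ _ , _   , (_ ∷ _ ∷ ()) , _)

avoids-by-inversion₁₂ : ∀ {P x y z} → (∀ {a b c} → a ∷ b ∷ c ∷ [] ⊆ P → a < b) → y < x →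
                        Avoids P (x ∷ y ∷ z ∷ [])
avoids-by-inversion₁₂ a<b y<x occ with _ , _ , _ , abc⊆ , iso ← occurrence₃ occ =
  <-asym (a<b abc⊆) (inversion₁₂ iso y<x)

avoids-by-inversion₁₃ : ∀ {P x y z} → FirstBelowThird P → z < x → Avoids P (x ∷ y ∷ z ∷ [])
avoids-by-inversion₁₃ a<c z<x occ with _ , _ , _ , abc⊆ , iso ← occurrence₃ occ =
  <-asym (a<c abc⊆) (inversion₁₃ iso z<x)

avoids-by-inversion₂₃ : ∀ {P x y z} → (∀ {a b c} → a ∷ b ∷ c ∷ [] ⊆ P → b < c) → z < y →
                        Avoids P (x ∷ y ∷ z ∷ [])
avoids-by-inversion₂₃ b<c z<y occ with _ , _ , _ , abc⊆ , iso ← occurrence₃ occ =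
  <-asym (b<c abc⊆) (inversion₂₃ iso z<y)

AllPairs-⊆ : ∀ {R : ℕ → ℕ → Set} {xs ys} → xs ⊆ ys → AllPairs R ys → AllPairs R xs
AllPairs-⊆ []          _            = []
AllPairs-⊆ (_ ∷ʳ xs⊆)  (_ ∷ Rys)    = AllPairs-⊆ xs⊆ Rys
AllPairs-⊆ (refl ∷ xs⊆) (Ry ∷ Rys) = All-resp-⊆ xs⊆ Ry ∷ AllPairs-⊆ xs⊆ Rys

increasing⇒first<second : ∀ {P a b s} → AllPairs _<_ P → a ∷ b ∷ s ⊆ P → a < b
increasing⇒first<second P↑ ab⊆ with (a<b ∷ _) ∷ _ ← AllPairs-⊆ ab⊆ P↑ = a<b

increasing-tail⇒second<third : ∀ {w P a b c} → AllPairs _<_ P → a ∷ b ∷ c ∷ [] ⊆ w ∷ P → b < c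
increasing-tail⇒second<third P↑ abc⊆ with (b<c ∷ []) ∷ _ ← AllPairs-⊆ (∷⁻ abc⊆) P↑ = b<c

Avoids-++ : ∀ {P} Q {τ} → Avoids (P ++ Q) τ → Avoids P τ
Avoids-++ Q avoids (s , s⊆P , iso) = avoids (s , ++⁺ʳ-⊆ Q s⊆P , iso)

Layered-interval : ∀ k → Layered k (interval 1 k)
Layered-interval zero    = []
Layered-interval (suc k) = subst (Layered (suc k)) (sym (interval-∷ʳ 1 k)) (fix (Layered-interval k))

Layered-swapFirst : ∀ j → Layered (2 + j) (2 ∷ 1 ∷ interval 3 j)
Layered-swapFirst zero    = swap []
Layered-swapFirst (suc j) =
  subst (Layered (3 + j)) (cong (λ R → 2 ∷ 1 ∷ R) (sym (interval-∷ʳ 3 j))) (fix (Layered-swapFirst j))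

Layered-avoiding-132 : ∀ {k P} → Layered k P → Avoids P (1 ∷ 3 ∷ 2 ∷ []) →
                       P ≡ interval 1 k ⊎ ∃[ j ] k ≡ 2 + j × P ≡ 2 ∷ 1 ∷ interval 3 j
Layered-avoiding-132 [] _ = inj₁ refl
Layered-avoiding-132 (fix {k} L) avoids with Layered-avoiding-132 L (Avoids-++ [ suc k ] avoids)
... | inj₁ refl           = inj₁ (sym (interval-∷ʳ 1 k))
... | inj₂ (j , refl , refl) = inj₂ (suc j , refl , cong (λ R → 2 ∷ 1 ∷ R) (sym (interval-∷ʳ 3 j)))
Layered-avoiding-132 (swap {P = []} L) _ with refl ← Layered-length L = inj₂ (0 , refl , refl)
Layered-avoiding-132 (swap {k} {a ∷ P} L) avoids = contradiction occurrence avoids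
  where
  a≤k = Layered-bounded L (here refl)
  occurrence : Contains (a ∷ P ++ 2 + k ∷ suc k ∷ []) (1 ∷ 3 ∷ 2 ∷ [])
  occurrence = _ , refl ∷ ++⁺ˡ-⊆ P ⊆-refl ,
               orderIso₃ (ascending (s≤s (≤-trans a≤k (n≤1+n k))) (s<s z<s)) (ascending (s≤s a≤k) (s<s z<s))
                         (descending ≤-refl (s<s (s<s z<s)))

Layered-avoiding-213 : ∀ {k P} → Layered k P → Avoids P (2 ∷ 1 ∷ 3 ∷ []) →
                       P ≡ interval 1 k ⊎ ∃[ j ] k ≡ 2 + j × P ≡ interval 1 j ++ 2 + j ∷ suc j ∷ []
Layered-avoiding-213 [] _ = inj₁ refl
Layered-avoiding-213 (fix {k} L) avoids with Layered-avoiding-213 L (Avoids-++ [ suc k ] avoids)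
... | inj₁ refl              = inj₁ (sym (interval-∷ʳ 1 k))
... | inj₂ (j , refl , refl) = contradiction occurrence avoids
  where
  occurrence : Contains ((interval 1 j ++ 2 + j ∷ suc j ∷ []) ++ [ 3 + j ]) (2 ∷ 1 ∷ 3 ∷ [])
  occurrence = _ , ++⁺-⊆ (++⁺ˡ-⊆ (interval 1 j) ⊆-refl) ⊆-refl ,
               orderIso₃ (descending ≤-refl (s<s z<s)) (ascending ≤-refl (s<s (s<s z<s)))
                         (ascending (n≤1+n _) (s<s z<s))
Layered-avoiding-213 (swap {k} L) avoids with Layered-avoiding-213 L (Avoids-++ (2 + k ∷ suc k ∷ []) avoids)
... | inj₁ refl              = inj₂ (k , refl , refl)
... | inj₂ (j , refl , refl) = contradiction occurrence avoids
  where
  occurrence : Contains ((interval 1 j ++ 2 + j ∷ suc j ∷ []) ++ 4 + j ∷ 3 + j ∷ []) (2 ∷ 1 ∷ 3 ∷ [])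
  occurrence = _ , ++⁺-⊆ (++⁺ˡ-⊆ (interval 1 j) ⊆-refl) (refl ∷ minimum _) ,
               orderIso₃ (descending ≤-refl (s<s z<s)) (ascending (n≤1+n _) (s<s (s<s z<s)))
                         (ascending (≤-trans (n≤1+n _) (n≤1+n _)) (s<s z<s))

Layered-ascent : ∀ {k P} → Layered k P → 3 ≤ k → ∃[ a ] ∃[ b ] a < b × b ≤ k × a ∷ b ∷ [] ⊆ P
Layered-ascent (fix {k} {P} L) (s≤s 2≤k) =
  1 , suc k , s≤s (≤-trans (s≤s z≤n) 2≤k) , ≤-refl ,
  ++⁺-⊆ (from∈ (Layered-covers L ≤-refl (≤-trans (s≤s z≤n) 2≤k))) ⊆-refl
Layered-ascent (swap {k} {P} L) (s≤s (s≤s 1≤k)) =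
  1 , 2 + k , s≤s (s≤s (≤-trans z≤n 1≤k)) , ≤-refl ,
  ++⁺-⊆ (from∈ (Layered-covers L ≤-refl 1≤k)) (refl ∷ minimum _)

increasing : ∀ {a b c} → a < b → b < c → OrderIso (a ∷ b ∷ c ∷ []) (1 ∷ 2 ∷ 3 ∷ [])
increasing a<b b<c =
  orderIso₃ (ascending a<b (s<s z<s)) (ascending (<-trans a<b b<c) (s<s z<s)) (ascending b<c (s<s (s<s z<s)))

Layered-contains-123 : ∀ {k P} → Layered k P → 5 ≤ k → Contains P (1 ∷ 2 ∷ 3 ∷ [])
Layered-contains-123 (fix L) (s≤s 4≤k) with _ , _ , a<b , b≤k , ab⊆ ← Layered-ascent L (≤-trans (n≤1+n 3) 4≤k) =
  _ , ++⁺-⊆ ab⊆ ⊆-refl , increasing a<b (s≤s b≤k)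
Layered-contains-123 (swap {k} L) (s≤s (s≤s 3≤k)) with _ , _ , a<b , b≤k , ab⊆ ← Layered-ascent L 3≤k =
  _ , ++⁺-⊆ ab⊆ (refl ∷ minimum _) , increasing a<b (s≤s (≤-trans b≤k (n≤1+n k)))

FixedAvoider⇔ : ∀ {n σ π} → FixedAvoider n σ π ⇔ (Layered n π × Avoids π σ)
FixedAvoider⇔ = mk⇔ (λ (perm , fixed , avoids) → Equivalence.to θ-fixed⇔Layered (perm , fixed) , avoids)
                    (λ (L , avoids) → let perm , fixed = Equivalence.from θ-fixed⇔Layered L
                                       in perm , fixed , avoids)

count-by-enumeration : ∀ {n σ k} (Ps : List (List ℕ)) → Unique Ps → length Ps ≡ k →
                       (∀ {π} → π ∈ Ps ⇔ (Layered n π × Avoids π σ)) → f1≡ n σ k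
count-by-enumeration Ps unique |Ps| enumerates =
  Ps , unique , (λ _ → ⇔-trans enumerates (⇔-sym FixedAvoider⇔)) , |Ps|

f1-inversion₁₃ : ∀ n {x y z} → z < x → f1≡ n (x ∷ y ∷ z ∷ []) (F (suc n))
f1-inversion₁₃ n z<x = count-by-enumeration (layerings n) (layerings-unique n) (length-layerings n) (mk⇔
  (λ π∈ → let L = ∈-layerings⁻ n π∈ in L , avoids-by-inversion₁₃ (Layered⇒FirstBelowThird L) z<x)
  (∈-layerings⁺ ∘ proj₁))

f1-132 : ∀ {n} → 2 ≤ n → f1≡ n (1 ∷ 3 ∷ 2 ∷ []) 2
f1-132 {suc (suc j)} (s≤s (s≤s z≤n)) =
  count-by-enumeration (identity ∷ swapFirst ∷ []) (((λ ()) ∷ []) ∷ [] ∷ []) refl (mk⇔ listed enumerated)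
  where
  identity = interval 1 (2 + j)
  swapFirst = 2 ∷ 1 ∷ interval 3 j
  2<3 = s<s (s<s z<s)
  1∷interval-increasing : AllPairs _<_ (1 ∷ interval 3 j)
  1∷interval-increasing =
    All.tabulate (λ x∈ → <-≤-trans (s<s z<s) (proj₁ (∈-interval⁻ 3 j x∈))) ∷ interval-increasing 3 j
  listed : ∀ {π} → π ∈ identity ∷ swapFirst ∷ [] → Layered (2 + j) π × Avoids π (1 ∷ 3 ∷ 2 ∷ [])
  listed (here refl)         = Layered-interval (2 + j) ,
    avoids-by-inversion₂₃ (increasing-tail⇒second<third (interval-increasing 2 (suc j))) 2<3
  listed (there (here refl)) = Layered-swapFirst j ,
    avoids-by-inversion₂₃ (increasing-tail⇒second<third 1∷interval-increasing) 2<3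
  enumerated : ∀ {π} → Layered (2 + j) π × Avoids π (1 ∷ 3 ∷ 2 ∷ []) → π ∈ identity ∷ swapFirst ∷ []
  enumerated (L , avoids) with Layered-avoiding-132 L avoids
  ... | inj₁ refl              = here refl
  ... | inj₂ (_ , refl , refl) = there (here refl)

f1-213 : ∀ {n} → 2 ≤ n → f1≡ n (2 ∷ 1 ∷ 3 ∷ []) 2
f1-213 {suc (suc j)} (s≤s (s≤s z≤n)) =
  count-by-enumeration (identity ∷ swapLast ∷ []) ((distinct ∷ []) ∷ [] ∷ []) refl (mk⇔ listed enumerated)
  where
  identity = interval 1 (2 + j)
  swapLast = interval 1 j ++ 2 + j ∷ suc j ∷ []
  1<2 = s<s z<s
  distinct : identity ≢ swapLast
  distinct eq = 1+n≢n (∷ʳ-injectiveʳ (interval 1 (suc j)) (interval 1 j ++ [ 2 + j ]) (begin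
    interval 1 (suc j) ++ [ 2 + j ]          ≡⟨ interval-∷ʳ 1 (suc j) ⟨
    identity                                 ≡⟨ eq ⟩
    swapLast                                 ≡⟨ ++-assoc (interval 1 j) [ 2 + j ] [ suc j ] ⟨
    (interval 1 j ++ [ 2 + j ]) ++ [ suc j ] ∎))
    where open ≡-Reasoning
  swapLast-first<second : ∀ {a b c} → a ∷ b ∷ c ∷ [] ⊆ swapLast → a < b
  swapLast-first<second abc⊆ with ⊆-++-triple (interval 1 j) ≤-refl abc⊆
  ... | inj₁ abc⊆I              = increasing⇒first<second (interval-increasing 1 j) abc⊆I
  ... | inj₂ (inj₁ (ab⊆I , _))  = increasing⇒first<second (interval-increasing 1 j) ab⊆I
  ... | inj₂ (inj₂ (a∈I , bc⊆)) =
    <-≤-trans (proj₂ (∈-interval⁻ 1 j a∈I)) (All.lookup {P = suc j ≤_} (n≤1+n _ ∷ ≤-refl ∷ []) (to∈ bc⊆))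
  listed : ∀ {π} → π ∈ identity ∷ swapLast ∷ [] → Layered (2 + j) π × Avoids π (2 ∷ 1 ∷ 3 ∷ [])
  listed (here refl)         = Layered-interval (2 + j) ,
    avoids-by-inversion₁₂ (increasing⇒first<second (interval-increasing 1 (2 + j))) 1<2
  listed (there (here refl)) = swap (Layered-interval j) , avoids-by-inversion₁₂ swapLast-first<second 1<2
  enumerated : ∀ {π} → Layered (2 + j) π × Avoids π (2 ∷ 1 ∷ 3 ∷ []) → π ∈ identity ∷ swapLast ∷ []
  enumerated (L , avoids) with Layered-avoiding-213 L avoids
  ... | inj₁ refl              = here refl
  ... | inj₂ (_ , refl , refl) = there (here refl)

f1-123 : ∀ {n} → 5 ≤ n → f1≡ n (1 ∷ 2 ∷ 3 ∷ []) 0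
f1-123 5≤n = count-by-enumeration [] [] refl
  (mk⇔ (λ ()) (λ (L , avoids) → contradiction (Layered-contains-123 L 5≤n) avoids))

theorem5p1 : (n : ℕ) → 5 ≤ n →
    f1≡ n (2 ∷ 3 ∷ 1 ∷ []) (F (suc n))
    × f1≡ n (3 ∷ 1 ∷ 2 ∷ []) (F (suc n))
    × f1≡ n (3 ∷ 2 ∷ 1 ∷ []) (F (suc n))
    × f1≡ n (1 ∷ 3 ∷ 2 ∷ []) 2
    × f1≡ n (2 ∷ 1 ∷ 3 ∷ []) 2
    × f1≡ n (1 ∷ 2 ∷ 3 ∷ []) 0
theorem5p1 n 5≤n =
  f1-inversion₁₃ n 1<2 , f1-inversion₁₃ n 2<3 , f1-inversion₁₃ n 1<3 ,
  f1-132 2≤n , f1-213 2≤n , f1-123 5≤n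
  where
  1<2 = s<s z<s
  2<3 = s<s (s<s z<s)
  1<3 = s<s z<s
  2≤n = ≤-trans (s≤s (s≤s z≤n)) 5≤n
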